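{- Let $S_\Delta$ be any one of the proof systems $\mathbb{K}^\Delta,\mathbb{KT}^\Delta,\mathbb{K4}^\Delta,\mathbb{K5}^\Delta,\mathbb{KB}^\Delta,\mathbb{S4}^\Delta,\mathbb{S5}^\Delta,\mathbb{K45}^\Delta$ described below, and let $S_D$ be $S_\Delta$ extended by the axiom schemas $\mathtt{D}_n$ for all $n\ge1$. Then for every formula $A$ of $\mathcal{L}_D$, $\vdash_{S_D}A\leftrightarrow t_D(A)$.
   Context: $\mathcal{L}_D$: $A::=p\mid\neg A\mid A\land A\mid D(A_1,\dots,A_n;A)$ for $n\in\mathbb{N}$; $\Delta B$ denotes $D(\,;B)$, and $\mathcal{L}_\Delta\subseteq\mathcal{L}_D$ is the fragment with only $\Delta$. For formulas $A_1,\dots,A_n$ and $T\subseteq\{1,\dots,n\}$, $B_T=C_1\land\cdots\land C_n$ with $C_i=A_i$ if $i\in T$, $C_i=\neg A_i$ otherwise. Translation $t_D:\mathcal{L}_D\to\mathcal{L}_\Delta$: $t_D(p)=p$, commutes with $\neg,\land$, and $t_D(D(A_1,\dots,A_n;B))=\bigwedge_{T\subseteq\{1,\dots,n\}}(\Delta(t_D(B_T)\to t_D(B))\vee\Delta(t_D(B_T)\to\neg t_D(B)))$. Axiom $\mathtt{D}_n$: $D(A_1,\dots,A_n;B)\leftrightarrow\bigwedge_{T\subseteq\{1,\dots,n\}}(\Delta(B_T\to B)\vee\Delta(B_T\to\neg B))$. System $\mathbb{K}^\Delta$: all propositional tautologies; $\Delta(A\to B)\land\Delta(\neg A\to B)\to\Delta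 B$; $\Delta A\to\Delta(A\to B)\vee\Delta(\neg A\to C)$; $\Delta A\leftrightarrow\Delta\neg A$; rules modus ponens, from $A$ infer $\Delta A$, from $A\leftrightarrow B$ infer $\Delta A\leftrightarrow\Delta B$. Extensions: $\mathbb{KT}^\Delta$ adds $\Delta A\land\Delta(A\to B)\land A\to\Delta B$ (call it $\mathtt{T}$); $\mathbb{K4}^\Delta$ adds $\Delta A\to\Delta(\Delta A\vee B)$ (call it $\mathtt{4}$); $\mathbb{K5}^\Delta$ adds $\neg\Delta A\to\Delta(\neg\Delta A\vee B)$ (call it $\mathtt{5}$); $\mathbb{KB}^\Delta$ adds $A\to\Delta((\Delta A\land\Delta(A\to B)\land\neg\Delta B)\to C)$; $\mathbb{S4}^\Delta$ adds $\mathtt{T}$ and $\Delta A\to\Delta\Delta A$; $\mathbb{S5}^\Delta$ adds $\mathtt{T}$ and $\neg\Delta A\to\Delta\neg\Delta A$; $\mathbb{K45}^\Delta$ adds $\mathtt{4}$ and $\mathtt{5}$. In $S_D$ these axioms and rules range over all $\mathcal{L}_D$ formulas. -}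

module Defs where

open import Data.Nat using (ℕ; zero)
open import Data.Bool using (Bool; true; false; not; _∧_; _∨_)
open import Data.List using (List; []; _∷_; map; _++_)
open import Data.Empty using (⊥)
open import Data.Unit using (⊤)
open import Relation.Binary.PropositionalEquality using (_≡_)

infixr 6 _∧'_
infixr 5 _∨'_
infixr 4 _⇒_
infix 3 _⇔_

-- Formulas of L_D.  D As B stands for D(A_1,...,A_n ; B) with As = A_1 ∷ ... ∷ A_n.
data Form : Set where
  var  : ℕ → Form
  ¬'_  : Form → Form
  _∧'_ : Form → Form → Form
  D    : List Form → Form → Form

Δ : Form → Form
Δ B = D [] B

_⇒_ : Form → Form → Form
A ⇒ B = ¬' (A ∧' ¬' B)

_∨'_ : Form → Form → Form
A ∨' B = ¬' (¬' A ∧' ¬' B)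

_⇔_ : Form → Form → Form
A ⇔ B = (A ⇒ B) ∧' (B ⇒ A)

-- a fixed tautology (only used for the never-occurring empty conjunction)
top : Form
top = var zero ⇒ var zero

bigAnd : List Form → Form
bigAnd []           = top
bigAnd (x ∷ [])     = x
bigAnd (x ∷ y ∷ ys) = x ∧' bigAnd (y ∷ ys)

-- for A_1..A_n, the list of all sign-choices [C_1..C_n] (C_i = A_i or ¬A_i),
-- one for each T ⊆ {1..n}
choices : List Form → List (List Form)
choices []       = [] ∷ []
choices (A ∷ As) = map (A ∷_) (choices As) ++ map ((¬' A) ∷_) (choices As)

bTs : List Form → List Form
bTs As = map bigAnd (choices As)

dBody : List Form → Form → Form
dBody As B = bigAnd (map (λ C → Δ (C ⇒ B) ∨' Δ (C ⇒ ¬' B)) (bTs As))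

-- The translation t_D : L_D → L_Δ.
-- Since t_D commutes with ¬ and ∧, t_D(B_T) is literally the B_T formed from t_D(A_i).
mutual
  tD : Form → Form
  tD (var p)        = var p
  tD (¬' A)         = ¬' tD A
  tD (A ∧' B)       = tD A ∧' tD B
  tD (D [] B)       = Δ (tD B)
  tD (D (A ∷ As) B) = dBody (tD A ∷ tDs As) (tD B)

  tDs : List Form → List Form
  tDs []       = []
  tDs (A ∷ As) = tD A ∷ tDs As

-- Propositional evaluation: modal formulas D(As;B) are treated as atoms.
eval : (ℕ → Bool) → (List Form → Form → Bool) → Form → Bool
eval v w (var p)  = v p
eval v w (¬' A)   = not (eval v w A)
eval v w (A ∧' B) = eval v w A ∧ eval v w B
eval v w (D As B) = w As B

Taut : Form → Set
Taut A = ∀ (v : ℕ → Bool) (w : List Form → Form → Bool) → eval v w A ≡ true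

data Sys : Set where
  K KT K4 K5 KB S4 S5 K45 : Sys

HasT : Sys → Set
HasT KT = ⊤
HasT S4 = ⊤
HasT S5 = ⊤
HasT _  = ⊥

Has4 : Sys → Set
Has4 K4  = ⊤
Has4 K45 = ⊤
Has4 _   = ⊥

Has5 : Sys → Set
Has5 K5  = ⊤
Has5 K45 = ⊤
Has5 _   = ⊥

HasB : Sys → Set
HasB KB = ⊤
HasB _  = ⊥

HasS4 : Sys → Set
HasS4 S4 = ⊤
HasS4 _  = ⊥

HasS5 : Sys → Set
HasS5 S5 = ⊤
HasS5 _  = ⊥

-- Derivability in S_D (the system s extended by D_n for all n ≥ 1),
-- all schemas ranging over all L_D formulas.
data _⊢_ (s : Sys) : Form → Set where
  taut  : ∀ {A} → Taut A → s ⊢ A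
  axK1  : ∀ A B → s ⊢ ((Δ (A ⇒ B) ∧' Δ (¬' A ⇒ B)) ⇒ Δ B)
  axK2  : ∀ A B C → s ⊢ (Δ A ⇒ (Δ (A ⇒ B) ∨' Δ (¬' A ⇒ C)))
  axK3  : ∀ A → s ⊢ (Δ A ⇔ Δ (¬' A))
  axT   : HasT s → ∀ A B → s ⊢ ((Δ A ∧' Δ (A ⇒ B) ∧' A) ⇒ Δ B)
  ax4   : Has4 s → ∀ A B → s ⊢ (Δ A ⇒ Δ (Δ A ∨' B))
  ax5   : Has5 s → ∀ A B → s ⊢ (¬' Δ A ⇒ Δ (¬' Δ A ∨' B))
  axB   : HasB s → ∀ A B C →
          s ⊢ (A ⇒ Δ ((Δ A ∧' Δ (A ⇒ B) ∧' ¬' Δ B) ⇒ C))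
  axS4  : HasS4 s → ∀ A → s ⊢ (Δ A ⇒ Δ (Δ A))
  axS5  : HasS5 s → ∀ A → s ⊢ (¬' Δ A ⇒ Δ (¬' Δ A))
  axD   : ∀ A As B → s ⊢ (D (A ∷ As) B ⇔ dBody (A ∷ As) B)
  mp    : ∀ {A B} → s ⊢ (A ⇒ B) → s ⊢ A → s ⊢ B
  nec   : ∀ {A} → s ⊢ A → s ⊢ Δ A
  re    : ∀ {A B} → s ⊢ (A ⇔ B) → s ⊢ (Δ A ⇔ Δ B)

module Submission where

-- The translation t_D changes a formula only inside its D-subformulas,
-- and the axiom D_n says precisely that D(A₁,…,Aₙ;B) is provably equivalent to the
-- formula dBody [A₁,…,Aₙ] B by which t_D replaces it.  So the theorem is a
-- replacement-of-equivalents argument by structural induction on A: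
--   * provable equivalence s ⊢ A ≋ B (that is, s ⊢ A ⇔ B) is reflexive, transitive
--     and a congruence for ¬ and ∧ (hence for ⇒ and ∨) — each of these is a
--     propositional tautology checked by a small truth table — and for Δ by rule RE;
--   * these congruences lift through the constructions choices, bigAnd and dBody,
--     so dBody respects pointwise-equivalent lists of arguments;
--   * in the case D(A ∷ As; B) the axiom D_n rewrites D to dBody, and the induction
--     hypotheses for A, As and B are fed to the congruence for dBody.

open import Defs
open import Data.Bool using (Bool; true; false; not; _∧_)
open import Data.List using (List; []; _∷_)
open import Data.List.Relation.Binary.Pointwise as Pointwise
  using (Pointwise; []; _∷_; map⁺; ++⁺)
open import Relation.Binary.PropositionalEquality using (_≡_; refl)

_⇒ᵇ_ : Bool → Bool → Bool
a ⇒ᵇ b = not (a ∧ not b)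

_⇔ᵇ_ : Bool → Bool → Bool
a ⇔ᵇ b = (a ⇒ᵇ b) ∧ (b ⇒ᵇ a)

infixr 4 _⇒ᵇ_
infix 5 _⇔ᵇ_

⇔ᵇ-refl : ∀ a → (a ⇔ᵇ a) ≡ true
⇔ᵇ-refl true  = refl
⇔ᵇ-refl false = refl

⇔ᵇ-trans : ∀ a b c → ((a ⇔ᵇ b) ⇒ᵇ (b ⇔ᵇ c) ⇒ᵇ (a ⇔ᵇ c)) ≡ true
⇔ᵇ-trans true  true  true  = refl
⇔ᵇ-trans true  true  false = refl
⇔ᵇ-trans true  false c     = refl
⇔ᵇ-trans false true  c     = refl
⇔ᵇ-trans false false true  = refl
⇔ᵇ-trans false false false = refl

⇔ᵇ-not : ∀ a b → ((a ⇔ᵇ b) ⇒ᵇ (not a ⇔ᵇ not b)) ≡ true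
⇔ᵇ-not true  true  = refl
⇔ᵇ-not true  false = refl
⇔ᵇ-not false true  = refl
⇔ᵇ-not false false = refl

⇔ᵇ-and : ∀ a a′ b b′ → ((a ⇔ᵇ a′) ⇒ᵇ (b ⇔ᵇ b′) ⇒ᵇ (a ∧ b ⇔ᵇ a′ ∧ b′)) ≡ true
⇔ᵇ-and true  false b     b′    = refl
⇔ᵇ-and false true  b     b′    = refl
⇔ᵇ-and true  true  true  true  = refl
⇔ᵇ-and true  true  true  false = refl
⇔ᵇ-and true  true  false true  = refl
⇔ᵇ-and true  true  false false = refl
⇔ᵇ-and false false true  true  = refl
⇔ᵇ-and false false true  false = refl
⇔ᵇ-and false false false true  = refl
⇔ᵇ-and false false false false = refl

infix 2 _⊢_≋_

_⊢_≋_ : Sys → Form → Form → Set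
s ⊢ A ≋ B = s ⊢ (A ⇔ B)

module Replacement {s : Sys} where

  ≋-refl : ∀ A → s ⊢ A ≋ A
  ≋-refl A = taut λ v w → ⇔ᵇ-refl (eval v w A)

  ≋-trans : ∀ {A B C} → s ⊢ A ≋ B → s ⊢ B ≋ C → s ⊢ A ≋ C
  ≋-trans {A} {B} {C} A≋B B≋C =
    mp (mp (taut λ v w → ⇔ᵇ-trans (eval v w A) (eval v w B) (eval v w C)) A≋B) B≋C

  ¬-cong : ∀ {A A′} → s ⊢ A ≋ A′ → s ⊢ ¬' A ≋ ¬' A′
  ¬-cong {A} {A′} A≋A′ = mp (taut λ v w → ⇔ᵇ-not (eval v w A) (eval v w A′)) A≋A′

  ∧-cong : ∀ {A A′ B B′} → s ⊢ A ≋ A′ → s ⊢ B ≋ B′ → s ⊢ A ∧' B ≋ A′ ∧' B′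
  ∧-cong {A} {A′} {B} {B′} A≋A′ B≋B′ =
    mp (mp (taut λ v w → ⇔ᵇ-and (eval v w A) (eval v w A′) (eval v w B) (eval v w B′))
           A≋A′)
       B≋B′

  ⇒-cong : ∀ {A A′ B B′} → s ⊢ A ≋ A′ → s ⊢ B ≋ B′ → s ⊢ (A ⇒ B) ≋ (A′ ⇒ B′)
  ⇒-cong A≋A′ B≋B′ = ¬-cong (∧-cong A≋A′ (¬-cong B≋B′))

  ∨-cong : ∀ {A A′ B B′} → s ⊢ A ≋ A′ → s ⊢ B ≋ B′ → s ⊢ A ∨' B ≋ A′ ∨' B′
  ∨-cong A≋A′ B≋B′ = ¬-cong (∧-cong (¬-cong A≋A′) (¬-cong B≋B′))

  _≋*_ : List Form → List Form → Set
  _≋*_ = Pointwise (λ A B → s ⊢ A ≋ B)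

  bigAnd-cong : ∀ {Cs Cs′} → Cs ≋* Cs′ → s ⊢ bigAnd Cs ≋ bigAnd Cs′
  bigAnd-cong []                      = ≋-refl top
  bigAnd-cong (C≋C′ ∷ [])             = C≋C′
  bigAnd-cong (C≋C′ ∷ Cs≋Cs′@(_ ∷ _)) = ∧-cong C≋C′ (bigAnd-cong Cs≋Cs′)

  choices-cong : ∀ {As As′} → As ≋* As′ → Pointwise _≋*_ (choices As) (choices As′)
  choices-cong []              = [] ∷ []
  choices-cong (A≋A′ ∷ As≋As′) =
    ++⁺ (map⁺ (_ ∷_) (_ ∷_) (Pointwise.map (A≋A′ ∷_) (choices-cong As≋As′)))
        (map⁺ (_ ∷_) (_ ∷_) (Pointwise.map (¬-cong A≋A′ ∷_) (choices-cong As≋As′)))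

  dBody-cong : ∀ {As As′ B B′} → As ≋* As′ → s ⊢ B ≋ B′ →
               s ⊢ dBody As B ≋ dBody As′ B′
  dBody-cong {B = B} {B′} As≋As′ B≋B′ =
    bigAnd-cong (map⁺ _ _ (Pointwise.map conjunct-cong
                  (map⁺ bigAnd bigAnd (Pointwise.map bigAnd-cong (choices-cong As≋As′)))))
    where
    conjunct-cong : ∀ {C C′} → s ⊢ C ≋ C′ →
                    s ⊢ Δ (C ⇒ B) ∨' Δ (C ⇒ ¬' B) ≋ Δ (C′ ⇒ B′) ∨' Δ (C′ ⇒ ¬' B′)
    conjunct-cong C≋C′ = ∨-cong (re (⇒-cong C≋C′ B≋B′)) (re (⇒-cong C≋C′ (¬-cong B≋B′)))

open Replacement

mutual
  proposition6p9 : (s : Sys) (A : Form) → s ⊢ (A ⇔ tD A)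
  proposition6p9 s (var p)        = ≋-refl (var p)
  proposition6p9 s (¬' A)         = ¬-cong (proposition6p9 s A)
  proposition6p9 s (A ∧' B)       = ∧-cong (proposition6p9 s A) (proposition6p9 s B)
  proposition6p9 s (D [] B)       = re (proposition6p9 s B)
  proposition6p9 s (D (A ∷ As) B) =
    ≋-trans (axD A As B)
            (dBody-cong (proposition6p9 s A ∷ tDs-equivalent s As) (proposition6p9 s B))

  tDs-equivalent : (s : Sys) (As : List Form) → _≋*_ {s} As (tDs As)
  tDs-equivalent s []       = []
  tDs-equivalent s (A ∷ As) = proposition6p9 s A ∷ tDs-equivalent s As
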